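{- Let $a$ be an approximate normal form and $\Pi\triangleright\Gamma\vdash_{\mathcal H} a:\sigma$. Then the number of typed positions $C\in\mathrm{tocc}(\Pi)$ such that the subterm of $a$ at position $C$ is a variable (free or bound) is at most $d(\Gamma,\sigma)$.
   Context: Approximate normal forms: $a::=\Omega\mid N$, $N::=\lambda x.N\mid L$, $L::=x\mid L\,a$, $\Omega$ a constant; bound variables are named apart from free ones and from each other. Types: $\sigma,\tau,\rho::=\alpha\mid A\to\tau$, $\alpha$ base types, multiset types $A=[\sigma_i]_{i\in I}$ finite possibly empty multisets of types. Environments $\Gamma$ map variables to multiset types, all but finitely many to $[\,]$; $(\Gamma+\Delta)(x)=\Gamma(x)\uplus\Delta(x)$; $\Gamma\setminus x$ sets $x$ to $[\,]$. System $\mathcal H$: (var) $x{:}[\rho]\vdash x:\rho$; ($\to$I) from $\Gamma\vdash t:\tau$ infer $\Gamma\setminus x\vdash\lambda x.t:\Gamma(x)\to\tau$; (m) from $(\Delta_i\vdash t:\sigma_i)_{i\in I}$ ($I$ finite, possibly empty) infer $+_{i\in I}\Delta_i\vdash t:[\sigma_i]_{i\in I}$; ($\to$E) from $\Gamma\vdash t:A\to\tau$ and $\Delta\vdash u:A$ infer $\Gamma+\Delta\vdash tu:\tau$; $\Omega$ is typable only by (m) with $I=\emptyset$. Typed positions: positions of $a$ are one-hole contexts $C$ with $C[u]=a$. $\mathrm{tocc}(\Pi)$ is $\{\square\}$ for (var); $\{\square\}\cup\{\lambda x.C:C\in\mathrm{tocc}(\Pi')\}$ for ($\to$I) with premise $\Pi'$;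 $\{\square\}\cup\{Cv:C\in\mathrm{tocc}(\Pi')\}\cup\{uC:C\in\mathrm{tocc}(\Pi'')\}$ for ($\to$E) with subject $uv$ and premises $\Pi'$ for $u$, $\Pi''$ for $v$; $\bigcup_i\mathrm{tocc}(\Pi_i)$ for (m) with premises $\Pi_i$ (empty if $I=\emptyset$). The degree $d(\Gamma,\sigma)$ is the sum of the cardinalities of all the multiset types occurring in $\sigma$ and in the types $\Gamma(x)$, $x$ a variable. -}

module Defs where

open import Data.Nat using (ℕ; _+_; _≟_; _≡ᵇ_)
open import Data.Bool using (if_then_else_)
open import Data.List using (List; []; _∷_; _++_; [_]; map; length; deduplicate)
open import Data.Nat.ListAction using (sum)
open import Data.List.Membership.Propositional using (_∈_; _∉_)
open import Data.List.Relation.Unary.Unique.Propositional using (Unique)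
open import Data.List.Relation.Binary.Permutation.Propositional using (_↭_)
open import Data.List.Relation.Binary.Pointwise using (Pointwise)
open import Data.Maybe using (Maybe; just; nothing)
open import Data.Product using (_×_; _,_; proj₁; ∃)
open import Relation.Binary.PropositionalEquality using (_≡_)

data Term : Set where
  var : ℕ → Term
  lam : ℕ → Term → Term
  app : Term → Term → Term
  Ω   : Term

mutual
  data IsA : Term → Set where
    a-Ω : IsA Ω
    a-N : ∀ {t} → IsN t → IsA t

  data IsN : Term → Set where
    n-lam : ∀ {x t} → IsN t → IsN (lam x t)
    n-L   : ∀ {t} → IsL t → IsN t

  data IsL : Term → Set where
    l-var : ∀ {x} → IsL (var x)
    l-app : ∀ {t u} → IsL t → IsA u → IsL (app t u)

fv : Term → List ℕ
fv (var x)   = [ x ]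
fv (lam x t) = remove x (fv t)
  where
  remove : ℕ → List ℕ → List ℕ
  remove x []       = []
  remove x (y ∷ ys) = if x ≡ᵇ y then remove x ys else y ∷ remove x ys
fv (app t u) = fv t ++ fv u
fv Ω         = []

bv : Term → List ℕ
bv (var x)   = []
bv (lam x t) = x ∷ bv t
bv (app t u) = bv t ++ bv u
bv Ω         = []

NamedApart : Term → Set
NamedApart a = Unique (bv a) × (∀ x → x ∈ bv a → x ∉ fv a)

-- Types; multiset types are represented by lists (taken up to the
-- relation _≈M_ : permutation, recursively on the element types)

data Ty : Set where
  base : ℕ → Ty
  _⇒_  : List Ty → Ty → Ty

infixr 5 _⇒_

MTy : Set
MTy = List Ty

mutual
  data _≈T_ : Ty → Ty → Set where
    base≈ : ∀ {α} → base α ≈T base α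
    ⇒≈    : ∀ {A B σ τ} → A ≈M B → σ ≈T τ → (A ⇒ σ) ≈T (B ⇒ τ)

  data _≈M_ : MTy → MTy → Set where
    perm≈ : ∀ {A C B} → A ↭ C → Pointwise _≈T_ C B → A ≈M B

-- Environments: finite lists of bindings x : σ.  Γ(x) is the multiset of
-- types bound to x; Γ + Δ is concatenation; Γ ∖ x removes x.

Env : Set
Env = List (ℕ × Ty)

_⟨_⟩ : Env → ℕ → MTy
[]            ⟨ x ⟩ = []
((y , σ) ∷ Γ) ⟨ x ⟩ = if x ≡ᵇ y then σ ∷ (Γ ⟨ x ⟩) else Γ ⟨ x ⟩

_∖_ : Env → ℕ → Env
[]            ∖ x = []
((y , σ) ∷ Γ) ∖ x = if x ≡ᵇ y then Γ ∖ x else (y , σ) ∷ (Γ ∖ x)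

_+E_ : Env → Env → Env
Γ +E Δ = Γ ++ Δ

infix 4 _⊢_∶_ _⊢m_∶_

mutual
  data _⊢_∶_ : Env → Term → Ty → Set where
    ax  : ∀ {x ρ} → [ (x , ρ) ] ⊢ var x ∶ ρ
    →I  : ∀ {Γ x t τ} → Γ ⊢ t ∶ τ → (Γ ∖ x) ⊢ lam x t ∶ ((Γ ⟨ x ⟩) ⇒ τ)
    →E  : ∀ {Γ Δ t u A B τ} → Γ ⊢ t ∶ (A ⇒ τ) → Δ ⊢m u ∶ B → B ≈M A →
          (Γ +E Δ) ⊢ app t u ∶ τ

  data _⊢m_∶_ : Env → Term → MTy → Set where
    m[] : ∀ {t} → [] ⊢m t ∶ []
    m∷  : ∀ {Δ Γ t σ A} → Δ ⊢ t ∶ σ → Γ ⊢m t ∶ A → (Δ +E Γ) ⊢m t ∶ (σ ∷ A)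

-- Positions (one-hole contexts) as paths from the root

data Dir : Set where
  inLam  : Dir
  inFun  : Dir
  inArg  : Dir

Pos : Set
Pos = List Dir

_at_ : Term → Pos → Maybe Term
t         at []            = just t
lam x t   at (inLam ∷ C)   = t at C
app t u   at (inFun ∷ C)   = t at C
app t u   at (inArg ∷ C)   = u at C
_         at (_ ∷ _)       = nothing

mutual
  tocc : ∀ {Γ t σ} → Γ ⊢ t ∶ σ → List Pos
  tocc ax           = [ [] ]
  tocc (→I Π)       = [] ∷ map (inLam ∷_) (tocc Π)
  tocc (→E Π Πs _)  = [] ∷ (map (inFun ∷_) (tocc Π) ++ map (inArg ∷_) (toccm Πs))

  toccm : ∀ {Γ t A} → Γ ⊢m t ∶ A → List Pos
  toccm m[]        = []
  toccm (m∷ Π Πs)  = tocc Π ++ toccm Πs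

VarAt : Term → Pos → Set
VarAt a C = ∃ λ x → a at C ≡ just (var x)

mutual
  degT : Ty → ℕ
  degT (base α) = 0
  degT (A ⇒ τ)  = degM A + degT τ

  degM : MTy → ℕ
  degM A = length A + degL A

  degL : MTy → ℕ
  degL []      = 0
  degL (σ ∷ A) = degT σ + degL A

dom : Env → List ℕ
dom Γ = deduplicate _≟_ (map proj₁ Γ)

degree : Env → Ty → ℕ
degree Γ σ = degT σ + sum (map (λ x → degM (Γ ⟨ x ⟩)) (dom Γ))

-- Every typed position holding a variable is the conclusion of a (var) rule, so it is enough to
-- count (var) rules.  Write deg Γ for the sum of 1 + deg τ over the bindings x : τ of Γ; it is the
-- environment part of d(Γ, σ), and it is additive under Γ + Δ.  In a neutral term x a₁ … aₙ the
-- type σ of the term and the multisets typing the arguments all occur inside the type of the head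
-- variable, a single binding of Γ; inductively this gives #var + deg σ ≤ deg Γ for neutral terms
-- and #var ≤ deg σ + deg Γ for normal ones, an abstraction merely moving Γ(x) from the environment
-- into the type.

module Submission where

open import Defs
open import Data.Bool using (true; false; if_then_else_)
open import Data.List using (List; []; _∷_; _++_; map; length)
open import Data.List.Properties using (length-++; length-map; map-++; map-cong)
open import Data.List.Membership.Propositional using (_∈_; _∉_)
open import Data.List.Membership.Propositional.Properties
  using (∈-map⁺; ∈-map⁻; ∈-++⁺ˡ; ∈-++⁺ʳ; ∈-++⁻; ∈-∃++; ∈-deduplicate⁺)
open import Data.List.Relation.Binary.Permutation.Propositional using (_↭_; refl; prep; swap; trans)
open import Data.List.Relation.Binary.Permutation.Propositional.Properties using (↭-length)
open import Data.List.Relation.Binary.Pointwise using (Pointwise; []; _∷_; Pointwise-length)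
open import Data.List.Relation.Binary.Subset.Propositional using (_⊆_)
open import Data.List.Relation.Unary.AllPairs using (_∷_)
open import Data.List.Relation.Unary.Any using (here; there)
open import Data.List.Relation.Unary.Unique.Propositional using (Unique)
open import Data.Nat using (ℕ; suc; _+_; _≤_; _≟_; _≡ᵇ_; z≤n; s≤s)
open import Data.Nat.ListAction using (sum)
open import Data.Nat.ListAction.Properties using (sum-++)
open import Data.Nat.Properties
  using (+-assoc; +-suc; +-identityʳ; m≤m+n; m≤n+m; n≤1+n; +-mono-≤; +-monoˡ-≤; +-monoʳ-≤;
         +-commutativeSemigroup; ≤-reflexive; module ≤-Reasoning)
open import Data.Nat.Tactic.RingSolver using (solve-∀)
open import Algebra.Properties.CommutativeSemigroup +-commutativeSemigroup
  using (interchange; x∙yz≈y∙xz; x∙yz≈zx∙y)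
open import Data.List.Relation.Unary.Unique.DecPropositional.Properties _≟_ using (deduplicate-!)
open import Data.List.Relation.Unary.Unique.Propositional.Properties using (Unique[x∷xs]⇒x∉xs)
open import Data.Product using (_×_; _,_; proj₁; proj₂)
open import Data.Sum using (inj₁; inj₂)
open import Function using (_∘_)
open import Relation.Binary.Definitions using (DecidableEquality)
open import Relation.Nullary using (yes; no; does; contradiction)
open import Relation.Binary.PropositionalEquality as ≡
  using (_≡_; refl; cong; cong₂; sym; module ≡-Reasoning)

Unique∧⊆⇒length≤ : ∀ {A : Set} {xs ys : List A} → Unique xs → xs ⊆ ys → length xs ≤ length ys
Unique∧⊆⇒length≤ {xs = []} _ _ = z≤n
Unique∧⊆⇒length≤ {xs = x ∷ xs} {ys} !x∷xs@(_ ∷ !xs) x∷xs⊆ys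
  with ys₁ , ys₂ , refl ← ∈-∃++ (x∷xs⊆ys (here refl)) = begin
    suc (length xs)                ≤⟨ s≤s (Unique∧⊆⇒length≤ !xs xs⊆ys₁++ys₂) ⟩
    suc (length (ys₁ ++ ys₂))      ≡⟨ cong suc (length-++ ys₁) ⟩
    suc (length ys₁ + length ys₂)  ≡⟨ sym (+-suc (length ys₁) (length ys₂)) ⟩
    length ys₁ + suc (length ys₂)  ≡⟨ sym (length-++ ys₁) ⟩
    length (ys₁ ++ x ∷ ys₂)        ∎
  where
  open ≤-Reasoning
  xs⊆ys₁++ys₂ : xs ⊆ ys₁ ++ ys₂
  xs⊆ys₁++ys₂ y∈xs with ∈-++⁻ ys₁ (x∷xs⊆ys (there y∈xs))
  ... | inj₁ y∈ys₁         = ∈-++⁺ˡ y∈ys₁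
  ... | inj₂ (here refl)   = contradiction y∈xs (Unique[x∷xs]⇒x∉xs !x∷xs)
  ... | inj₂ (there y∈ys₂) = ∈-++⁺ʳ ys₁ y∈ys₂

sum-map-+ : ∀ {A : Set} (f g : A → ℕ) xs →
  sum (map (λ x → f x + g x) xs) ≡ sum (map f xs) + sum (map g xs)
sum-map-+ f g []       = refl
sum-map-+ f g (x ∷ xs) =
  ≡.trans (cong (f x + g x +_) (sum-map-+ f g xs)) (interchange (f x) (g x) _ _)

sum-map-≡0 : ∀ {A : Set} {f : A → ℕ} → (∀ x → f x ≡ 0) → ∀ xs → sum (map f xs) ≡ 0
sum-map-≡0 f≡0 []       = refl
sum-map-≡0 f≡0 (x ∷ xs) = cong₂ _+_ (f≡0 x) (sum-map-≡0 f≡0 xs)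

module _ {A : Set} (_≟_ : DecidableEquality A) where

  indicator : A → ℕ → A → ℕ
  indicator z k y = if does (y ≟ z) then k else 0

  sum-indicator-∉ : ∀ {z L} k → z ∉ L → sum (map (indicator z k) L) ≡ 0
  sum-indicator-∉ {L = []}    k z∉ = refl
  sum-indicator-∉ {z} {y ∷ L} k z∉ with y ≟ z
  ... | yes refl = contradiction (here refl) z∉
  ... | no _     = sum-indicator-∉ k (λ z∈L → z∉ (there z∈L))

  sum-indicator-∈ : ∀ {z L} k → Unique L → z ∈ L → sum (map (indicator z k) L) ≡ k
  sum-indicator-∈ {z} {y ∷ L} k !y∷L@(_ ∷ !L) z∈y∷L with y ≟ z | z∈y∷L
  ... | yes refl | _         =
    ≡.trans (cong (k +_) (sum-indicator-∉ k (Unique[x∷xs]⇒x∉xs !y∷L))) (+-identityʳ k)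
  ... | no y≢z   | here refl = contradiction refl y≢z
  ... | no _     | there z∈L = sum-indicator-∈ k !L z∈L

degM-∷ : ∀ σ A → degM (σ ∷ A) ≡ suc (degT σ) + degM A
degM-∷ σ A = cong suc (x∙yz≈y∙xz (length A) (degT σ) (degL A))

degL-↭ : ∀ {A B} → A ↭ B → degL A ≡ degL B
degL-↭ refl                   = refl
degL-↭ (prep σ A↭B)           = cong (degT σ +_) (degL-↭ A↭B)
degL-↭ (swap {A} {B} σ τ A↭B) = begin
  degT σ + (degT τ + degL A)  ≡⟨ x∙yz≈y∙xz (degT σ) (degT τ) (degL A) ⟩
  degT τ + (degT σ + degL A)  ≡⟨ cong (λ n → degT τ + (degT σ + n)) (degL-↭ A↭B) ⟩
  degT τ + (degT σ + degL B)  ∎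
  where open ≡-Reasoning
degL-↭ (trans A↭C C↭B)        = ≡.trans (degL-↭ A↭C) (degL-↭ C↭B)

mutual
  degT-≈ : ∀ {σ τ} → σ ≈T τ → degT σ ≡ degT τ
  degT-≈ base≈       = refl
  degT-≈ (⇒≈ A≈B σ≈τ) = cong₂ _+_ (degM-≈ A≈B) (degT-≈ σ≈τ)

  degM-≈ : ∀ {A B} → A ≈M B → degM A ≡ degM B
  degM-≈ (perm≈ A↭C C≈B) =
    cong₂ _+_ (≡.trans (↭-length A↭C) (Pointwise-length C≈B))
              (≡.trans (degL-↭ A↭C) (degL-pointwise C≈B))

  degL-pointwise : ∀ {A B} → Pointwise _≈T_ A B → degL A ≡ degL B
  degL-pointwise []            = refl
  degL-pointwise (σ≈τ ∷ A≈B)   = cong₂ _+_ (degT-≈ σ≈τ) (degL-pointwise A≈B)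

degE : Env → ℕ
degE Γ = sum (map (suc ∘ degT ∘ proj₂) Γ)

degE-++ : ∀ Γ Δ → degE (Γ ++ Δ) ≡ degE Γ + degE Δ
degE-++ Γ Δ = ≡.trans (cong sum (map-++ weight Γ Δ)) (sum-++ (map weight Γ) (map weight Δ))
  where
  weight : ℕ × Ty → ℕ
  weight = suc ∘ degT ∘ proj₂

degE-∖ : ∀ Γ x → degE (Γ ∖ x) + degM (Γ ⟨ x ⟩) ≡ degE Γ
degE-∖ []            x = refl
degE-∖ ((y , σ) ∷ Γ) x with x ≡ᵇ y
... | true  = begin
  degE (Γ ∖ x) + degM (σ ∷ Γ ⟨ x ⟩)                ≡⟨ cong (degE (Γ ∖ x) +_) (degM-∷ σ (Γ ⟨ x ⟩)) ⟩
  degE (Γ ∖ x) + (suc (degT σ) + degM (Γ ⟨ x ⟩))  ≡⟨ x∙yz≈y∙xz (degE (Γ ∖ x)) (suc (degT σ)) (degM (Γ ⟨ x ⟩)) ⟩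
  suc (degT σ) + (degE (Γ ∖ x) + degM (Γ ⟨ x ⟩))  ≡⟨ cong (suc (degT σ) +_) (degE-∖ Γ x) ⟩
  suc (degT σ) + degE Γ                           ∎
  where open ≡-Reasoning
... | false = ≡.trans (+-assoc (suc (degT σ)) _ _) (cong (suc (degT σ) +_) (degE-∖ Γ x))

degAt : Env → ℕ → ℕ
degAt Γ x = degM (Γ ⟨ x ⟩)

degM-if : ∀ b σ A → degM (if b then σ ∷ A else A) ≡ (if b then suc (degT σ) else 0) + degM A
degM-if true  σ A = degM-∷ σ A
degM-if false σ A = refl

degAt-∷ : ∀ z σ Γ y → degAt ((z , σ) ∷ Γ) y ≡ indicator _≟_ z (suc (degT σ)) y + degAt Γ y
degAt-∷ z σ Γ y = degM-if (y ≡ᵇ z) σ (Γ ⟨ y ⟩)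

sum-degAt : ∀ Γ {L} → Unique L → map proj₁ Γ ⊆ L → sum (map (degAt Γ) L) ≡ degE Γ
sum-degAt []            {L} _  _      = sum-map-≡0 (λ _ → refl) L
sum-degAt ((z , σ) ∷ Γ) {L} !L Γ⊆L = begin
  sum (map (degAt ((z , σ) ∷ Γ)) L)            ≡⟨ cong sum (map-cong (degAt-∷ z σ Γ) L) ⟩
  sum (map (λ y → ind y + degAt Γ y) L)         ≡⟨ sum-map-+ ind (degAt Γ) L ⟩
  sum (map ind L) + sum (map (degAt Γ) L)       ≡⟨ cong₂ _+_ (sum-indicator-∈ _≟_ _ !L (Γ⊆L (here refl)))
                                                              (sum-degAt Γ !L (λ x∈Γ → Γ⊆L (there x∈Γ))) ⟩
  suc (degT σ) + degE Γ                         ∎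
  where
  open ≡-Reasoning
  ind : ℕ → ℕ
  ind = indicator _≟_ z (suc (degT σ))

degree≡degT+degE : ∀ Γ σ → degree Γ σ ≡ degT σ + degE Γ
degree≡degT+degE Γ σ =
  cong (degT σ +_) (sum-degAt Γ (deduplicate-! (map proj₁ Γ)) (∈-deduplicate⁺ _≟_))

mutual
  varPositions : ∀ {Γ t σ} → Γ ⊢ t ∶ σ → List Pos
  varPositions ax           = [] ∷ []
  varPositions (→I Π)       = map (inLam ∷_) (varPositions Π)
  varPositions (→E Π Πs _)  = map (inFun ∷_) (varPositions Π) ++ map (inArg ∷_) (varPositionsᵐ Πs)

  varPositionsᵐ : ∀ {Γ t A} → Γ ⊢m t ∶ A → List Pos
  varPositionsᵐ m[]        = []
  varPositionsᵐ (m∷ Π Πs)  = varPositions Π ++ varPositionsᵐ Πs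

mutual
  ∈tocc∧VarAt⇒∈varPositions : ∀ {Γ t σ} (Π : Γ ⊢ t ∶ σ) {C} → C ∈ tocc Π → VarAt t C → C ∈ varPositions Π
  ∈tocc∧VarAt⇒∈varPositions ax          C∈ _ = C∈
  ∈tocc∧VarAt⇒∈varPositions (→I Π)      (here refl) (_ , ())
  ∈tocc∧VarAt⇒∈varPositions (→I Π)      (there C∈) atVar
    with C′ , C′∈ , refl ← ∈-map⁻ (inLam ∷_) C∈ =
    ∈-map⁺ (inLam ∷_) (∈tocc∧VarAt⇒∈varPositions Π C′∈ atVar)
  ∈tocc∧VarAt⇒∈varPositions (→E Π Πs _) (here refl) (_ , ())
  ∈tocc∧VarAt⇒∈varPositions (→E Π Πs _) (there C∈) atVar
    with ∈-++⁻ (map (inFun ∷_) (tocc Π)) C∈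
  ... | inj₁ C∈fun with C′ , C′∈ , refl ← ∈-map⁻ (inFun ∷_) C∈fun =
    ∈-++⁺ˡ (∈-map⁺ (inFun ∷_) (∈tocc∧VarAt⇒∈varPositions Π C′∈ atVar))
  ... | inj₂ C∈arg with C′ , C′∈ , refl ← ∈-map⁻ (inArg ∷_) C∈arg =
    ∈-++⁺ʳ (map (inFun ∷_) (varPositions Π)) (∈-map⁺ (inArg ∷_) (∈toccᵐ∧VarAt⇒∈varPositionsᵐ Πs C′∈ atVar))

  ∈toccᵐ∧VarAt⇒∈varPositionsᵐ : ∀ {Γ t A} (Πs : Γ ⊢m t ∶ A) {C} →
    C ∈ toccm Πs → VarAt t C → C ∈ varPositionsᵐ Πs
  ∈toccᵐ∧VarAt⇒∈varPositionsᵐ (m∷ Π Πs) C∈ atVar with ∈-++⁻ (tocc Π) C∈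
  ... | inj₁ C∈Π  = ∈-++⁺ˡ (∈tocc∧VarAt⇒∈varPositions Π C∈Π atVar)
  ... | inj₂ C∈Πs = ∈-++⁺ʳ (varPositions Π) (∈toccᵐ∧VarAt⇒∈varPositionsᵐ Πs C∈Πs atVar)

mutual
  varCount : ∀ {Γ t σ} → Γ ⊢ t ∶ σ → ℕ
  varCount ax          = 1
  varCount (→I Π)      = varCount Π
  varCount (→E Π Πs _) = varCount Π + varCountᵐ Πs

  varCountᵐ : ∀ {Γ t A} → Γ ⊢m t ∶ A → ℕ
  varCountᵐ m[]       = 0
  varCountᵐ (m∷ Π Πs) = varCount Π + varCountᵐ Πs

mutual
  length-varPositions : ∀ {Γ t σ} (Π : Γ ⊢ t ∶ σ) → length (varPositions Π) ≡ varCount Π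
  length-varPositions ax          = refl
  length-varPositions (→I Π)      = ≡.trans (length-map _ (varPositions Π)) (length-varPositions Π)
  length-varPositions (→E Π Πs _) = begin
    length (map (inFun ∷_) (varPositions Π) ++ map (inArg ∷_) (varPositionsᵐ Πs))
      ≡⟨ length-++ (map (inFun ∷_) (varPositions Π)) ⟩
    length (map (inFun ∷_) (varPositions Π)) + length (map (inArg ∷_) (varPositionsᵐ Πs))
      ≡⟨ cong₂ _+_ (length-map _ (varPositions Π)) (length-map _ (varPositionsᵐ Πs)) ⟩
    length (varPositions Π) + length (varPositionsᵐ Πs)
      ≡⟨ cong₂ _+_ (length-varPositions Π) (length-varPositionsᵐ Πs) ⟩
    varCount Π + varCountᵐ Πs ∎
    where open ≡-Reasoning

  length-varPositionsᵐ : ∀ {Γ t A} (Πs : Γ ⊢m t ∶ A) → length (varPositionsᵐ Πs) ≡ varCountᵐ Πs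
  length-varPositionsᵐ m[]       = refl
  length-varPositionsᵐ (m∷ Π Πs) =
    ≡.trans (length-++ (varPositions Π)) (cong₂ _+_ (length-varPositions Π) (length-varPositionsᵐ Πs))

IsA∧typable⇒IsN : ∀ {Γ t σ} → IsA t → Γ ⊢ t ∶ σ → IsN t
IsA∧typable⇒IsN a-Ω     ()
IsA∧typable⇒IsN (a-N N) _ = N

open ≤-Reasoning

mutual
  IsN⇒varCount≤ : ∀ {Γ t σ} → IsN t → (Π : Γ ⊢ t ∶ σ) → varCount Π ≤ degT σ + degE Γ
  IsN⇒varCount≤ (n-lam N) (→I {Γ} {x} {τ = τ} Π) = begin
    varCount Π                                  ≤⟨ IsN⇒varCount≤ N Π ⟩
    degT τ + degE Γ                             ≡⟨ cong (degT τ +_) (sym (degE-∖ Γ x)) ⟩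
    degT τ + (degE (Γ ∖ x) + degM (Γ ⟨ x ⟩))  ≡⟨ x∙yz≈zx∙y (degT τ) (degE (Γ ∖ x)) (degM (Γ ⟨ x ⟩)) ⟩
    (degM (Γ ⟨ x ⟩) + degT τ) + degE (Γ ∖ x)  ∎
  IsN⇒varCount≤ {Γ} {σ = σ} (n-L L) Π = begin
    varCount Π            ≤⟨ m≤m+n (varCount Π) (degT σ) ⟩
    varCount Π + degT σ   ≤⟨ IsL⇒varCount+degT≤ L Π ⟩
    degE Γ                ≤⟨ m≤n+m (degE Γ) (degT σ) ⟩
    degT σ + degE Γ       ∎

  -- The head variable's type contains the type of a neutral term, so that type is paid for by Γ.
  IsL⇒varCount+degT≤ : ∀ {Γ t σ} → IsL t → (Π : Γ ⊢ t ∶ σ) → varCount Π + degT σ ≤ degE Γ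
  IsL⇒varCount+degT≤ l-var (ax {ρ = ρ}) = ≤-reflexive (cong suc (sym (+-identityʳ (degT ρ))))
  IsL⇒varCount+degT≤ (l-app L U) (→E {Γ} {Δ} {A = A} {B} {τ} Π Πs B≈A) = begin
    varCount Π + varCountᵐ Πs + degT τ
      ≤⟨ +-monoˡ-≤ (degT τ) (+-monoʳ-≤ (varCount Π) (IsA⇒varCountᵐ≤ U Πs)) ⟩
    varCount Π + (degM B + degE Δ) + degT τ
      ≡⟨ cong (λ n → varCount Π + (n + degE Δ) + degT τ) (degM-≈ B≈A) ⟩
    varCount Π + (degM A + degE Δ) + degT τ
      ≡⟨ +-+-exchange (varCount Π) (degM A) (degE Δ) (degT τ) ⟩
    varCount Π + (degM A + degT τ) + degE Δ
      ≤⟨ +-monoˡ-≤ (degE Δ) (IsL⇒varCount+degT≤ L Π) ⟩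
    degE Γ + degE Δ
      ≡⟨ sym (degE-++ Γ Δ) ⟩
    degE (Γ ++ Δ) ∎
    where
    +-+-exchange : ∀ a b c d → a + (b + c) + d ≡ a + (b + d) + c
    +-+-exchange = solve-∀

  IsA⇒varCountᵐ≤ : ∀ {Γ t A} → IsA t → (Πs : Γ ⊢m t ∶ A) → varCountᵐ Πs ≤ degM A + degE Γ
  IsA⇒varCountᵐ≤ _       m[]        = z≤n
  IsA⇒varCountᵐ≤ (a-N N) (m∷ {Δ} {Γ} {σ = σ} {A} Π Πs) = begin
    varCount Π + varCountᵐ Πs               ≤⟨ +-mono-≤ (IsN⇒varCount≤ N Π) (IsA⇒varCountᵐ≤ (a-N N) Πs) ⟩
    (degT σ + degE Δ) + (degM A + degE Γ)   ≡⟨ interchange (degT σ) (degE Δ) (degM A) (degE Γ) ⟩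
    (degT σ + degM A) + (degE Δ + degE Γ)   ≤⟨ +-mono-≤ (+-monoˡ-≤ (degM A) (n≤1+n (degT σ))) (≤-reflexive (sym (degE-++ Δ Γ))) ⟩
    (suc (degT σ) + degM A) + degE (Δ ++ Γ) ≡⟨ cong (_+ degE (Δ ++ Γ)) (sym (degM-∷ σ A)) ⟩
    degM (σ ∷ A) + degE (Δ ++ Γ)            ∎

mainTheorem6 : ∀ {Γ a σ} → IsA a → NamedApart a → (Π : Γ ⊢ a ∶ σ) →
    (Cs : List Pos) → Unique Cs → (∀ C → C ∈ Cs → C ∈ tocc Π × VarAt a C) →
    length Cs ≤ degree Γ σ
mainTheorem6 {Γ} {a} {σ} isA _ Π Cs !Cs Cs-typed-var = begin
  length Cs                ≤⟨ Unique∧⊆⇒length≤ !Cs Cs⊆varPositions ⟩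
  length (varPositions Π)  ≡⟨ length-varPositions Π ⟩
  varCount Π               ≤⟨ IsN⇒varCount≤ (IsA∧typable⇒IsN isA Π) Π ⟩
  degT σ + degE Γ          ≡⟨ sym (degree≡degT+degE Γ σ) ⟩
  degree Γ σ               ∎
  where
  Cs⊆varPositions : Cs ⊆ varPositions Π
  Cs⊆varPositions {C} C∈Cs = ∈tocc∧VarAt⇒∈varPositions Π (proj₁ C-typed-var) (proj₂ C-typed-var)
    where
    C-typed-var : C ∈ tocc Π × VarAt a C
    C-typed-var = Cs-typed-var C C∈Cs
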